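{- For every (possibly partial) Boolean function $f:\{0,1\}^n\times\{0,1\}^n\to\{0,1\}$ we have $GH(f)\geq N(f)-1$.
   Context: Garden-hose model: Alice holds $x$, Bob holds $y$. A garden-hose protocol of size $s$ consists of a set $V$ of $s$ vertices (pipes) and an extra vertex $t$ (the tap), together with an assignment of a matching $E_A(x)$ on $V\cup\{t\}$ to every input $x$ of Alice and a matching $E_B(y)$ on $V$ to every input $y$ of Bob. In the graph $(V\cup\{t\},E_A(x)\cup E_B(y))$ every vertex has degree at most 2, so there is a unique maximal path starting at $t$ (of length 0 if $t$ is unmatched); the output on $(x,y)$ is the parity of the number of edges of this path. The protocol computes $f$ if the output equals $f(x,y)$ for every $(x,y)$ on which $f$ is defined. $GH(f)$ is the minimum size of a garden-hose protocol computing $f$. $N(f)$ is the (two-sided) non-deterministic communication complexity: the minimal worst-case communication of a two-player protocol in which Alice and Bob may make non-deterministic guesses and output one of accept, reject, undecided, such that for each $(x,y)$ with $f(x,y)=1$ some guess leads to accept and no guess leads to reject, and for each $(x,y)$ with $f(x,y)=0$ some guess leads to reject and no guess leads to accept. -}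

module Defs where

open import Data.Bool using (Bool; true; false; not)
open import Data.Nat using (ℕ; zero; suc)
open import Data.Fin using (Fin; zero; suc; _≟_)
open import Data.Vec using (Vec)
open import Data.Maybe using (Maybe; just; nothing)
open import Data.Product using (Σ; _×_; _,_; ∃; ∃-syntax)
open import Relation.Nullary using (yes; no; ¬_)
open import Relation.Binary.PropositionalEquality using (_≡_)

Input : ℕ → Set
Input n = Vec Bool n

-- f x y ≡ nothing  means f is undefined on (x , y)
PartialFn : ℕ → Set
PartialFn n = Input n → Input n → Maybe Bool

-- A matching on the vertex set Fin k, given as an involution:
-- v is matched to σ v when σ v ≢ v, and unmatched when σ v ≡ v.
record Matching (k : ℕ) : Set where
  field
    σ     : Fin k → Fin k
    invol : ∀ v → σ (σ v) ≡ v
open Matching public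

-- Vertex set V ∪ {t} = Fin (suc s); the tap t is  zero,  pipes are  suc i.
tap : {s : ℕ} → Fin (suc s)
tap = zero

-- A garden-hose protocol of size s for inputs in {0,1}^n.
-- Alice's matching is on V ∪ {t}; Bob's matching is on V (it leaves t unmatched).
record GHProtocol (n s : ℕ) : Set where
  field
    EA     : Input n → Matching (suc s)
    EB     : Input n → Matching (suc s)
    EB-tap : ∀ y → σ (EB y) tap ≡ tap
open GHProtocol public

-- Number of edges of the maximal path starting at v whose first edge is
-- taken from matching A, then alternating B, A, B, ...  (fuel bounds the
-- number of edges; it never runs out when fuel ≥ number of vertices - 1).
walk : {k : ℕ} → ℕ → (Fin k → Fin k) → (Fin k → Fin k) → Fin k → ℕ
walk zero    A B v = zero
walk (suc m) A B v with A v ≟ v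
... | yes _ = zero
... | no  _ = suc (walk m B A (A v))

odd : ℕ → Bool
odd zero    = false
odd (suc m) = not (odd m)

-- Output: parity of the number of edges of the maximal path from the tap in
-- the graph (V ∪ {t}, E_A(x) ∪ E_B(y)).  The path has at most s edges.
ghOutput : {n s : ℕ} → GHProtocol n s → Input n → Input n → Bool
ghOutput {s = s} P x y = odd (walk (suc s) (σ (EA P x)) (σ (EB P y)) tap)

GHComputes : {n s : ℕ} → GHProtocol n s → PartialFn n → Set
GHComputes {n} P f = ∀ (x y : Input n) (b : Bool) → f x y ≡ just b → ghOutput P x y ≡ b

HasGH : {n : ℕ} → PartialFn n → ℕ → Set
HasGH {n} f s = Σ (GHProtocol n s) λ P → GHComputes P f

data Out : Set where
  accept reject undecided : Out

-- Deterministic two-party protocol trees on Alice-inputs A and Bob-inputs B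
-- with worst-case communication (depth) at most c; output is a function of
-- the transcript (leaf).
data Prot (A B : Set) : ℕ → Set where
  leaf  : ∀ {c} → Out → Prot A B c
  alice : ∀ {c} → (A → Bool) → (Prot A B c) → (Prot A B c) → Prot A B (suc c)
  bob   : ∀ {c} → (B → Bool) → (Prot A B c) → (Prot A B c) → Prot A B (suc c)

-- (first subtree: message false, second: message true)
run : ∀ {A B c} → Prot A B c → A → B → Out
run (leaf o)      a b = o
run (alice m p q) a b with m a
... | false = run p a b
... | true  = run q a b
run (bob m p q)   a b with m b
... | false = run p a b
... | true  = run q a b

-- A non-deterministic protocol: Alice privately guesses gA ∈ {0,1}^kA and Bob
-- privately guesses gB ∈ {0,1}^kB; then they run a deterministic protocol on
-- (x , gA) and (y , gB).
record NDProtocol (n c : ℕ) : Set where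
  field
    kA kB : ℕ
    prot  : Prot (Input n × Vec Bool kA) (Input n × Vec Bool kB) c
open NDProtocol public

ndRun : ∀ {n c} (P : NDProtocol n c) → Input n → Vec Bool (kA P) → Input n → Vec Bool (kB P) → Out
ndRun P x gA y gB = run (prot P) (x , gA) (y , gB)

NDComputes : ∀ {n c} → NDProtocol n c → PartialFn n → Set
NDComputes {n} P f = ∀ (x y : Input n) →
    (f x y ≡ just true →
       (∃[ gA ] ∃[ gB ] ndRun P x gA y gB ≡ accept)
     × (∀ gA gB → ¬ (ndRun P x gA y gB ≡ reject)))
  × (f x y ≡ just false →
       (∃[ gA ] ∃[ gB ] ndRun P x gA y gB ≡ reject)
     × (∀ gA gB → ¬ (ndRun P x gA y gB ≡ accept)))

HasN : {n : ℕ} → PartialFn n → ℕ → Set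
HasN {n} f c = Σ (NDProtocol n c) λ P → NDComputes P f

-- Alice guesses the set S of vertices the water flows through and sends it (s bits:
-- the tap is always in S).  She checks that S is closed under her matching and that
-- |S| is odd if S contains a vertex she leaves unmatched; Bob checks that S is closed
-- under his matching and that |S| is even if S contains a vertex other than the tap
-- that he leaves unmatched, and sends one bit saying whether his check passed.  The
-- vertex set of the path from the tap passes both checks and has one element more
-- than the path has edges.  Conversely, a set containing the tap and closed under
-- both matchings contains the whole path, whose last vertex is unmatched by Alice if
-- the path has even length and is a non-tap vertex unmatched by Bob if it has odd
-- length; so both checks together force |S| to have the parity of the honest set.

module Submission where

open import Data.Bool using (Bool; true; false; not; if_then_else_) renaming (_≟_ to _≟ᵇ_)
open import Data.Bool.Properties using (not-injective; not-¬; ¬-not)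
open import Data.Empty using (⊥; ⊥-elim)
open import Data.Fin using (Fin; zero; suc; _≟_; toℕ)
open import Data.Fin.Properties using (pigeonhole; toℕ<n; all?)
open import Data.Fin.Subset using (Subset; inside; outside; _∈_; _∉_; ⁅_⁆; _∪_; ∣_∣)
open import Data.Fin.Subset.Properties using (_∈?_; x∈⁅x⁆; x∈⁅y⁆⇒x≡y; x∈p∪q⁺; x∈p∪q⁻; ∪-identityʳ; ∣⁅x⁆∣≡1)
open import Data.Maybe using (just)
open import Data.Nat using (ℕ; zero; suc; _≤_; _<_; z≤n; s≤s; z<s)
open import Data.Nat.Properties using (≤-pred; ≤-refl; m≤n⇒m≤1+n; m≤n⇒m<n∨m≡n; n<1+n; <⇒≤)
open import Data.Product using (_×_; _,_; ∃-syntax)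
open import Data.Sum using (_⊎_; inj₁; inj₂; [_,_])
open import Data.Vec using (Vec; []; _∷_; head; tail; here; there)
open import Function using (_∘_; id)
open import Relation.Nullary using (¬_; Dec; yes; no; does; contradiction)
open import Relation.Nullary.Decidable using (dec-true; _×-dec_; _⊎-dec_; _→-dec_)
open import Relation.Binary.PropositionalEquality
  using (_≡_; _≢_; refl; sym; trans; cong; cong₂; subst; module ≡-Reasoning)

open import Defs

x∉p⇒∣p∪⁅x⁆∣≡1+∣p∣ : ∀ {k} {x : Fin k} {p : Subset k} → x ∉ p → ∣ p ∪ ⁅ x ⁆ ∣ ≡ suc ∣ p ∣
x∉p⇒∣p∪⁅x⁆∣≡1+∣p∣ {x = zero}  {outside ∷ p} _   = cong suc (cong ∣_∣ (∪-identityʳ p))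
x∉p⇒∣p∪⁅x⁆∣≡1+∣p∣ {x = zero}  {inside  ∷ p} x∉p = contradiction here x∉p
x∉p⇒∣p∪⁅x⁆∣≡1+∣p∣ {x = suc x} {outside ∷ p} x∉p = x∉p⇒∣p∪⁅x⁆∣≡1+∣p∣ (x∉p ∘ there)
x∉p⇒∣p∪⁅x⁆∣≡1+∣p∣ {x = suc x} {inside  ∷ p} x∉p = cong suc (x∉p⇒∣p∪⁅x⁆∣≡1+∣p∣ (x∉p ∘ there))

module _ {k : ℕ} where

  trail : (X Y : Fin k → Fin k) → Fin k → ℕ → Fin k
  trail X Y v zero    = v
  trail X Y v (suc j) = trail Y X (X v) j

  stepAt : (X Y : Fin k → Fin k) → ℕ → Fin k → Fin k
  stepAt X Y zero    = X
  stepAt X Y (suc j) = stepAt Y X j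

  StopsAt : (X Y : Fin k → Fin k) → Fin k → ℕ → Set
  StopsAt X Y v j = stepAt X Y j (trail X Y v j) ≡ trail X Y v j

  trail-suc : ∀ X Y v j → trail X Y v (suc j) ≡ stepAt X Y j (trail X Y v j)
  trail-suc X Y v zero    = refl
  trail-suc X Y v (suc j) = trail-suc Y X (X v) j

  stepAt-odd : ∀ X Y j → stepAt X Y j ≡ (if odd j then Y else X)
  stepAt-odd X Y zero    = refl
  stepAt-odd X Y (suc j) with odd j | stepAt-odd Y X j
  ... | true  | eq = eq
  ... | false | eq = eq

  walk-moves : ∀ m X Y v i → i < walk m X Y v → ¬ StopsAt X Y v i
  walk-moves (suc m) X Y v i i<w with X v ≟ v
  walk-moves (suc m) X Y v zero    _          | no X-moves = X-moves
  walk-moves (suc m) X Y v (suc i) (s≤s i<w) | no _       = walk-moves m Y X (X v) i i<w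

  walk-stops-or-runs-out : ∀ m X Y v → StopsAt X Y v (walk m X Y v) ⊎ walk m X Y v ≡ m
  walk-stops-or-runs-out zero    X Y v = inj₂ refl
  walk-stops-or-runs-out (suc m) X Y v with X v ≟ v
  ... | yes X-fixes = inj₁ X-fixes
  ... | no  _       with walk-stops-or-runs-out m Y X (X v)
  ...   | inj₁ stops = inj₁ stops
  ...   | inj₂ eq    = inj₂ (cong suc eq)

odd⇒positive : ∀ j → odd j ≡ true → 0 < j
odd⇒positive (suc j) _ = z<s

module _ {k : ℕ} where

  Closed : (Fin k → Fin k) → Subset k → Set
  Closed X M = ∀ v → v ∈ M → X v ∈ M

  AliceAccepts : (Fin k → Fin k) → Subset k → Set
  AliceAccepts A M = Closed A M × (∀ v → v ∈ M → A v ≡ v → odd ∣ M ∣ ≡ true)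

  BobAccepts : Fin k → (Fin k → Fin k) → Subset k → Set
  BobAccepts t B M = Closed B M × (∀ v → v ∈ M → B v ≡ v → v ≡ t ⊎ odd ∣ M ∣ ≡ false)

module Path {k : ℕ} {A B : Fin k → Fin k}
            (A-invol : ∀ v → A (A v) ≡ v) (B-invol : ∀ v → B (B v) ≡ v)
            {t : Fin k} (B-fixes-t : B t ≡ t) where

  matching : Bool → Fin k → Fin k
  matching b = if b then B else A

  matching-invol : ∀ b v → matching b (matching b v) ≡ v
  matching-invol false = A-invol
  matching-invol true  = B-invol

  p : ℕ → Fin k
  p = trail A B t

  p-suc : ∀ j → p (suc j) ≡ matching (odd j) (p j)
  p-suc j = trans (trail-suc A B t j) (cong (λ X → X (p j)) (stepAt-odd A B j))

  p-pred : ∀ j → matching (odd j) (p (suc j)) ≡ p j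
  p-pred j = trans (cong (matching (odd j)) (p-suc j)) (matching-invol (odd j) (p j))

  Stops : ℕ → Set
  Stops j = matching (odd j) (p j) ≡ p j

  -- A repetition p i ≡ p j is moved one step back at both ends when i and j have the
  -- same parity, and one step inwards otherwise, until it becomes a stop before N.
  distinct : ∀ {N} → (∀ j → j < N → ¬ Stops j) → ∀ j i → i < j → j ≤ N → p i ≢ p j
  distinct moves (suc j) i (s≤s i≤j) j<N p-i≡p-j with odd i ≟ᵇ odd j
  ... | yes same = go (m≤n⇒m<n∨m≡n i≤j)
    where
    p-suc-i≡p-j : p (suc i) ≡ p j
    p-suc-i≡p-j = begin
      p (suc i)                         ≡⟨ p-suc i ⟩
      matching (odd i) (p i)            ≡⟨ cong₂ matching same p-i≡p-j ⟩
      matching (odd j) (p (suc j))      ≡⟨ p-pred j ⟩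
      p j                               ∎
      where open ≡-Reasoning
    go : suc i ≤ j ⊎ i ≡ j → ⊥
    go (inj₂ refl) = moves i j<N (trans (sym (p-suc i)) p-suc-i≡p-j)
    go (inj₁ i<j) with m≤n⇒m<n∨m≡n i<j
    ... | inj₁ suc-i<j = distinct moves j (suc i) suc-i<j (<⇒≤ j<N) p-suc-i≡p-j
    ... | inj₂ refl    = not-¬ refl same
  distinct moves (suc j) zero _ j<N t≡p-j | no differ =
    distinct moves j zero (odd⇒positive j odd-j) (<⇒≤ j<N) (sym p-j≡t)
    where
    odd-j : odd j ≡ true
    odd-j = ¬-not (differ ∘ sym)
    p-j≡t : p j ≡ t
    p-j≡t = begin
      p j                           ≡⟨ sym (p-pred j) ⟩
      matching (odd j) (p (suc j))  ≡⟨ cong₂ matching odd-j (sym t≡p-j) ⟩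
      B t                           ≡⟨ B-fixes-t ⟩
      t                             ∎
      where open ≡-Reasoning
  distinct moves (suc j) (suc i) (s≤s i<j) j<N p-suc-i≡p-j | no differ =
    distinct moves j i i<j (<⇒≤ j<N) p-i≡p-j
    where
    p-i≡p-j : p i ≡ p j
    p-i≡p-j = begin
      p i                           ≡⟨ sym (p-pred i) ⟩
      matching (odd i) (p (suc i))  ≡⟨ cong₂ matching (not-injective (¬-not differ)) p-suc-i≡p-j ⟩
      matching (odd j) (p (suc j))  ≡⟨ p-pred j ⟩
      p j                           ∎
      where open ≡-Reasoning

  eventually-stops : ¬ (∀ j → j < k → ¬ Stops j)
  eventually-stops moves with pigeonhole (n<1+n k) (p ∘ toℕ)
  ... | i , j , i<j , p-i≡p-j = distinct moves (toℕ j) (toℕ i) i<j (≤-pred (toℕ<n j)) p-i≡p-j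

  L : ℕ
  L = walk k A B t

  StopsAt≡Stops : ∀ j → StopsAt A B t j ≡ Stops j
  StopsAt≡Stops j = cong (λ X → X (p j) ≡ p j) (stepAt-odd A B j)

  moves : ∀ j → j < L → ¬ Stops j
  moves j j<L = walk-moves k A B t j j<L ∘ subst id (sym (StopsAt≡Stops j))

  stops : Stops L
  stops with walk-stops-or-runs-out k A B t
  ... | inj₁ stops-at = subst id (StopsAt≡Stops L) stops-at
  ... | inj₂ L≡k      = ⊥-elim (eventually-stops λ j j<k → moves j (subst (j <_) (sym L≡k) j<k))

  visited : ℕ → Subset k
  visited zero    = ⁅ t ⁆
  visited (suc l) = visited l ∪ ⁅ p (suc l) ⁆

  visited⁺ : ∀ {j} l → j ≤ l → p j ∈ visited l
  visited⁺ zero    z≤n = x∈⁅x⁆ t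
  visited⁺ (suc l) j≤1+l with m≤n⇒m<n∨m≡n j≤1+l
  ... | inj₁ (s≤s j≤l) = x∈p∪q⁺ (inj₁ (visited⁺ l j≤l))
  ... | inj₂ refl      = x∈p∪q⁺ (inj₂ (x∈⁅x⁆ (p (suc l))))

  visited⁻ : ∀ {v} l → v ∈ visited l → ∃[ j ] j ≤ l × p j ≡ v
  visited⁻ zero    v∈ = 0 , z≤n , sym (x∈⁅y⁆⇒x≡y t v∈)
  visited⁻ (suc l) v∈ with x∈p∪q⁻ (visited l) ⁅ p (suc l) ⁆ v∈
  ... | inj₁ v∈l with visited⁻ l v∈l
  ...   | j , j≤l , p-j≡v = j , m≤n⇒m≤1+n j≤l , p-j≡v
  visited⁻ (suc l) v∈ | inj₂ v≡ = suc l , ≤-refl , sym (x∈⁅y⁆⇒x≡y (p (suc l)) v≡)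

  ∣visited∣ : ∀ l → l ≤ L → ∣ visited l ∣ ≡ suc l
  ∣visited∣ zero    _   = ∣⁅x⁆∣≡1 t
  ∣visited∣ (suc l) l<L = trans (x∉p⇒∣p∪⁅x⁆∣≡1+∣p∣ new) (cong suc (∣visited∣ l (<⇒≤ l<L)))
    where
    new : p (suc l) ∉ visited l
    new p∈ with visited⁻ l p∈
    ... | j , j≤l , p-j≡ = distinct moves (suc l) j (s≤s j≤l) l<L p-j≡

  waterSet : Subset k
  waterSet = visited L

  odd∣waterSet∣ : odd ∣ waterSet ∣ ≡ not (odd L)
  odd∣waterSet∣ = cong odd (∣visited∣ L ≤-refl)

  t∈waterSet : t ∈ waterSet
  t∈waterSet = visited⁺ L z≤n

  forward∈waterSet : ∀ j → j ≤ L → matching (odd j) (p j) ∈ waterSet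
  forward∈waterSet j j≤L with m≤n⇒m<n∨m≡n j≤L
  ... | inj₁ j<L = subst (_∈ waterSet) (p-suc j) (visited⁺ L j<L)
  ... | inj₂ refl = subst (_∈ waterSet) (sym stops) (visited⁺ L ≤-refl)

  backward : ∀ b j → odd j ≢ b → (j ≡ 0 × b ≡ true) ⊎ ∃[ i ] j ≡ suc i × matching b (p j) ≡ p i
  backward b zero    differ = inj₁ (refl , ¬-not (differ ∘ sym))
  backward b (suc i) differ = inj₂ (i , refl , trans (cong (λ c → matching c (p (suc i))) (sym odd-i≡b)) (p-pred i))
    where
    odd-i≡b : odd i ≡ b
    odd-i≡b = not-injective (¬-not differ)

  waterSet-closed : ∀ b → Closed (matching b) waterSet
  waterSet-closed b v v∈ with visited⁻ L v∈
  ... | j , j≤L , refl with odd j ≟ᵇ b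
  ...   | yes refl = forward∈waterSet j j≤L
  ...   | no differ with backward b j differ
  ...     | inj₁ (refl , refl)   = subst (_∈ waterSet) (sym B-fixes-t) t∈waterSet
  ...     | inj₂ (i , refl , eq) = subst (_∈ waterSet) (sym eq) (visited⁺ L (<⇒≤ j≤L))

  fixed-on-path : ∀ b j → j ≤ L → matching b (p j) ≡ p j → (j ≡ L × odd L ≡ b) ⊎ (j ≡ 0 × b ≡ true)
  fixed-on-path b j j≤L fixes with odd j ≟ᵇ b
  ... | yes refl with m≤n⇒m<n∨m≡n j≤L
  ...   | inj₁ j<L = ⊥-elim (moves j j<L fixes)
  ...   | inj₂ refl = inj₁ (refl , refl)
  fixed-on-path b j j≤L fixes | no differ with backward b j differ
  ... | inj₁ at-tap = inj₂ at-tap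
  ... | inj₂ (i , refl , eq) = ⊥-elim (distinct moves (suc i) i ≤-refl j≤L (trans (sym eq) fixes))

  waterSet-AliceAccepts : AliceAccepts A waterSet
  waterSet-AliceAccepts = waterSet-closed false , odd-if-fixed
    where
    odd-if-fixed : ∀ v → v ∈ waterSet → A v ≡ v → odd ∣ waterSet ∣ ≡ true
    odd-if-fixed v v∈ fixes with visited⁻ L v∈
    ... | j , j≤L , refl with fixed-on-path false j j≤L fixes
    ...   | inj₁ (_ , odd-L≡false) = trans odd∣waterSet∣ (cong not odd-L≡false)
    ...   | inj₂ (_ , ())

  waterSet-BobAccepts : BobAccepts t B waterSet
  waterSet-BobAccepts = waterSet-closed true , tap-or-even-if-fixed
    where
    tap-or-even-if-fixed : ∀ v → v ∈ waterSet → B v ≡ v → v ≡ t ⊎ odd ∣ waterSet ∣ ≡ false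
    tap-or-even-if-fixed v v∈ fixes with visited⁻ L v∈
    ... | j , j≤L , refl with fixed-on-path true j j≤L fixes
    ...   | inj₁ (_ , odd-L≡true) = inj₂ (trans odd∣waterSet∣ (cong not odd-L≡true))
    ...   | inj₂ (refl , _)       = inj₁ refl

  path⊆closed : ∀ {M} → t ∈ M → Closed A M → Closed B M → ∀ j → p j ∈ M
  path⊆closed {M} t∈M A-closed B-closed = go
    where
    closed : ∀ b → Closed (matching b) M
    closed false = A-closed
    closed true  = B-closed
    go : ∀ j → p j ∈ M
    go zero    = t∈M
    go (suc j) = subst (_∈ M) (sym (p-suc j)) (closed (odd j) (p j) (go j))

  end-fixed : ∀ {b} → odd L ≡ b → matching b (p L) ≡ p L
  end-fixed refl = stops

  accepted-parity : ∀ {M} → t ∈ M → AliceAccepts A M → BobAccepts t B M → not (odd ∣ M ∣) ≡ odd L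
  accepted-parity t∈M (A-closed , A-fixed) (B-closed , B-fixed) with odd L in odd-L
  ... | false = cong not (A-fixed (p L) (path⊆closed t∈M A-closed B-closed L) (end-fixed odd-L))
  ... | true  with B-fixed (p L) (path⊆closed t∈M A-closed B-closed L) (end-fixed odd-L)
  ...   | inj₁ end≡t = ⊥-elim (distinct moves L 0 (odd⇒positive L odd-L) ≤-refl (sym end≡t))
  ...   | inj₂ even  = cong not even

module _ {k : ℕ} where

  closed? : (X : Fin k → Fin k) (M : Subset k) → Dec (Closed X M)
  closed? X M = all? λ v → v ∈? M →-dec X v ∈? M

  aliceAccepts? : (A : Fin k → Fin k) (M : Subset k) → Dec (AliceAccepts A M)
  aliceAccepts? A M = closed? A M ×-dec all? λ v → v ∈? M →-dec A v ≟ v →-dec odd ∣ M ∣ ≟ᵇ true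

  bobAccepts? : (t : Fin k) (B : Fin k → Fin k) (M : Subset k) → Dec (BobAccepts t B M)
  bobAccepts? t B M = closed? B M ×-dec all? λ v → v ∈? M →-dec B v ≟ v →-dec (v ≟ t ⊎-dec odd ∣ M ∣ ≟ᵇ false)

module _ {A B : Set} where

  run-alice : ∀ {c} (h : A → Bool) (l r : Prot A B c) (a : A) (b : B) →
              run (alice h l r) a b ≡ (if h a then run r a b else run l a b)
  run-alice h l r a b with h a
  ... | false = refl
  ... | true  = refl

  run-bob : ∀ {c} (h : B → Bool) (o : Bool → Out) (a : A) (b : B) →
            run (bob {c = c} h (leaf (o false)) (leaf (o true))) a b ≡ o (h b)
  run-bob h o a b with h b
  ... | false = refl
  ... | true  = refl

  aliceSends : ∀ m → (A → Vec Bool m) → (Vec Bool m → Prot A B 1) → Prot A B (suc m)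
  aliceSends zero    msg k = k []
  aliceSends (suc m) msg k =
    alice (head ∘ msg) (aliceSends m (tail ∘ msg) (k ∘ (false ∷_))) (aliceSends m (tail ∘ msg) (k ∘ (true ∷_)))

  run-aliceSends : ∀ m msg k a b → run (aliceSends m msg k) a b ≡ run (k (msg a)) a b
  run-aliceSends zero msg k a b with msg a
  ... | [] = refl
  run-aliceSends (suc m) msg k a b = begin
    run (aliceSends (suc m) msg k) a b
      ≡⟨ run-alice (head ∘ msg) _ _ a b ⟩
    (if head (msg a) then run (aliceSends m (tail ∘ msg) (k ∘ (true ∷_))) a b
                     else run (aliceSends m (tail ∘ msg) (k ∘ (false ∷_))) a b)
      ≡⟨ cong₂ (if head (msg a) then_else_) (run-aliceSends m (tail ∘ msg) _ a b)
                                             (run-aliceSends m (tail ∘ msg) _ a b) ⟩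
    (if head (msg a) then run (k (true ∷ tail (msg a))) a b else run (k (false ∷ tail (msg a))) a b)
      ≡⟨ head-case (msg a) ⟩
    run (k (msg a)) a b ∎
    where
    open ≡-Reasoning
    head-case : ∀ w → (if head w then run (k (true ∷ tail w)) a b else run (k (false ∷ tail w)) a b) ≡ run (k w) a b
    head-case (false ∷ _) = refl
    head-case (true  ∷ _) = refl

answer : Bool → Out
answer true  = accept
answer false = reject

undecided≢answer : ∀ b → undecided ≢ answer b
undecided≢answer true  ()
undecided≢answer false ()

answer-not : ∀ b → answer b ≢ answer (not b)
answer-not true  ()
answer-not false ()

computes-by-certificates : ∀ {n c} (P : NDProtocol n c) (f : PartialFn n) (value : Input n → Input n → Bool) →
  (∀ x y b → f x y ≡ just b → value x y ≡ b) →
  (∀ x y → ∃[ gA ] ∃[ gB ] ndRun P x gA y gB ≡ answer (value x y)) →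
  (∀ x y gA gB → ndRun P x gA y gB ≡ undecided ⊎ ndRun P x gA y gB ≡ answer (value x y)) →
  NDComputes P f
computes-by-certificates P f value agrees certified sound x y =
  (decides true ∘ agrees x y true) , (decides false ∘ agrees x y false)
  where
  decides : ∀ b → value x y ≡ b →
    (∃[ gA ] ∃[ gB ] ndRun P x gA y gB ≡ answer b) × (∀ gA gB → ndRun P x gA y gB ≢ answer (not b))
  decides b refl = certified x y , λ gA gB wrong →
    [ (λ undec → undecided≢answer (not b) (trans (sym undec) wrong))
    , (λ right → answer-not b (trans (sym right) wrong)) ] (sound x y gA gB)

tap∈⇒inside∷tail : ∀ {s} {M : Subset (suc s)} → tap ∈ M → inside ∷ tail M ≡ M
tap∈⇒inside∷tail {M = inside ∷ _} here = refl

module FromGardenHose {n s : ℕ} (P : GHProtocol n s) where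

  A B : Input n → Fin (suc s) → Fin (suc s)
  A x = σ (EA P x)
  B y = σ (EB P y)

  module Water (x y : Input n) = Path {A = A x} {B = B y} (invol (EA P x)) (invol (EB P y)) (EB-tap P y)

  module WaterWithoutBob (x : Input n) = Path {A = A x} {B = id} (invol (EA P x)) (λ _ → refl) {tap} refl

  -- A message w stands for the vertex set inside ∷ w.  A guess Alice rejects is
  -- replaced by a set she accepts, the water set for a Bob who connects nothing.
  aliceMessage : Input n → Subset s → Subset s
  aliceMessage x w with aliceAccepts? (A x) (inside ∷ w)
  ... | yes _ = w
  ... | no  _ = tail (WaterWithoutBob.waterSet x)

  aliceMessage-accepted : ∀ x w → AliceAccepts (A x) (inside ∷ aliceMessage x w)
  aliceMessage-accepted x w with aliceAccepts? (A x) (inside ∷ w)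
  ... | yes accepted = accepted
  ... | no  _        = subst (AliceAccepts (A x)) (sym (tap∈⇒inside∷tail (WaterWithoutBob.t∈waterSet x)))
                             (WaterWithoutBob.waterSet-AliceAccepts x)

  aliceMessage-honest : ∀ x w → AliceAccepts (A x) (inside ∷ w) → aliceMessage x w ≡ w
  aliceMessage-honest x w accepted with aliceAccepts? (A x) (inside ∷ w)
  ... | yes _        = refl
  ... | no  rejected = contradiction accepted rejected

  bobBit : Input n → Subset s → Bool
  bobBit y w = does (bobAccepts? tap (B y) (inside ∷ w))

  outcome : Subset s → Bool → Out
  outcome w false = undecided
  outcome w true  = answer (not (odd ∣ inside ∷ w ∣))

  protocol : NDProtocol n (suc s)
  protocol = record
    { kA = s ; kB = 0
    ; prot = aliceSends s (λ (x , g) → aliceMessage x g) λ w →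
               bob (λ (y , _) → bobBit y w) (leaf (outcome w false)) (leaf (outcome w true))
    }

  run-protocol : ∀ x g y gB → ndRun protocol x g y gB ≡ outcome (aliceMessage x g) (bobBit y (aliceMessage x g))
  run-protocol x g y gB =
    trans (run-aliceSends s _ _ (x , g) (y , gB))
          (run-bob (λ (y , _) → bobBit y (aliceMessage x g)) (outcome (aliceMessage x g)) (x , g) (y , gB))

  accepted-outcome : ∀ x y w → AliceAccepts (A x) (inside ∷ w) → BobAccepts tap (B y) (inside ∷ w) →
                     outcome w true ≡ answer (ghOutput P x y)
  accepted-outcome x y w alice-accepts bob-accepts = cong answer (Water.accepted-parity x y here alice-accepts bob-accepts)

  bob-decides : ∀ x y w → AliceAccepts (A x) (inside ∷ w) → (d : Dec (BobAccepts tap (B y) (inside ∷ w))) →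
                outcome w (does d) ≡ undecided ⊎ outcome w (does d) ≡ answer (ghOutput P x y)
  bob-decides x y w alice-accepts (yes bob-accepts) = inj₂ (accepted-outcome x y w alice-accepts bob-accepts)
  bob-decides x y w alice-accepts (no _)            = inj₁ refl

  sound : ∀ x y g gB → ndRun protocol x g y gB ≡ undecided ⊎ ndRun protocol x g y gB ≡ answer (ghOutput P x y)
  sound x y g gB rewrite run-protocol x g y gB =
    bob-decides x y (aliceMessage x g) (aliceMessage-accepted x g) (bobAccepts? tap (B y) _)

  certified : ∀ x y → ∃[ gA ] ∃[ gB ] ndRun protocol x gA y gB ≡ answer (ghOutput P x y)
  certified x y = certificate , [] , (begin
    ndRun protocol x certificate y []                        ≡⟨ run-protocol x certificate y [] ⟩
    outcome (aliceMessage x certificate) (bobBit y (aliceMessage x certificate))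
      ≡⟨ cong (λ w → outcome w (bobBit y w)) (aliceMessage-honest x certificate alice-accepts) ⟩
    outcome certificate (bobBit y certificate)
      ≡⟨ cong (outcome certificate) (dec-true (bobAccepts? tap (B y) _) bob-accepts) ⟩
    outcome certificate true                                 ≡⟨ accepted-outcome x y certificate alice-accepts bob-accepts ⟩
    answer (ghOutput P x y)                                  ∎)
    where
    open ≡-Reasoning
    open Water x y
    certificate : Subset s
    certificate = tail waterSet
    encodes : inside ∷ certificate ≡ waterSet
    encodes = tap∈⇒inside∷tail t∈waterSet
    alice-accepts : AliceAccepts (A x) (inside ∷ certificate)
    alice-accepts = subst (AliceAccepts (A x)) (sym encodes) waterSet-AliceAccepts
    bob-accepts : BobAccepts tap (B y) (inside ∷ certificate)
    bob-accepts = subst (BobAccepts tap (B y)) (sym encodes) waterSet-BobAccepts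

theorem1 : (n : ℕ) (f : PartialFn n) (s : ℕ) → HasGH f s → HasN f (suc s)
theorem1 n f s (P , P-computes) =
  protocol , computes-by-certificates protocol f (ghOutput P) P-computes certified sound
  where open FromGardenHose P
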